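{- Let $G=(V,E)$ be a finite simple undirected graph with complement $G^c$. Suppose that (P2) every edge $e\in E$ lies in a unique triangle (3-cycle) of $G$, and (P3) every non-edge $e\in E^c$ lies in a unique quadrilateral (4-cycle) of $G^c$. Then $G^c$ contains no triangle, i.e. there are no three vertices of $G$ that are pairwise non-adjacent in $G$.
   Context: A triangle is a cycle of length 3 and a quadrilateral is a cycle of length 4, regarded as subgraphs; $G^c$ is the graph on $V$ whose edges are the pairs of distinct vertices not joined in $G$. -}

module Defs where

open import Data.Nat using (ℕ)
open import Data.Fin using (Fin)
open import Data.Product using (Σ; _×_; _,_)
open import Relation.Binary.PropositionalEquality using (_≡_; _≢_; refl) renaming (sym to ≡-sym)
open import Relation.Nullary using (¬_)

record SimpleGraph (n : ℕ) : Set₁ where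
  field
    Adj   : Fin n → Fin n → Set
    sym   : ∀ {u v} → Adj u v → Adj v u
    irrefl : ∀ {u} → ¬ Adj u u

open SimpleGraph public

complement : ∀ {n} → SimpleGraph n → SimpleGraph n
complement G = record
  { Adj    = λ u v → (u ≢ v) × ¬ Adj G u v
  ; sym    = λ { (u≢v , ¬a) → (λ e → u≢v (≡-sym e))
                            , (λ a → ¬a (SimpleGraph.sym G a)) }
  ; irrefl = λ { (u≢u , _) → u≢u refl }
  }

Unique : ∀ {A : Set} → (A → Set) → Set
Unique {A} P = Σ A λ a → P a × (∀ b → P b → b ≡ a)

-- Triangles of G containing the edge {u,v}: they are exactly the subgraphs
-- with vertex set {u,v,w} where w is adjacent to both u and v
-- (w ≠ u, v follows from irreflexivity). Distinct w give distinct triangles.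
TriangleThrough : ∀ {n} → SimpleGraph n → Fin n → Fin n → Fin n → Set
TriangleThrough G u v w = Adj G u w × Adj G v w

-- Quadrilaterals (4-cycles, as subgraphs) of G containing the edge {u,v}:
-- the cycle u - v - x - y - u with u,v,x,y pairwise distinct and edges
-- vx, xy, yu in G. Such a cycle is determined by, and determines, the pair (x , y).
QuadThrough : ∀ {n} → SimpleGraph n → Fin n → Fin n → Fin n × Fin n → Set
QuadThrough G u v (x , y) =
  (u ≢ v) × (u ≢ x) × (u ≢ y) × (v ≢ x) × (v ≢ y) × (x ≢ y) ×
  Adj G v x × Adj G x y × Adj G y u

P2 : ∀ {n} → SimpleGraph n → Set
P2 G = ∀ u v → Adj G u v → Unique (TriangleThrough G u v)

P3 : ∀ {n} → SimpleGraph n → Set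
P3 G = ∀ u v → Adj (complement G) u v → Unique (QuadThrough (complement G) u v)

HasTriangle : ∀ {n} → SimpleGraph n → Set
HasTriangle {n} G = Σ (Fin n) λ u → Σ (Fin n) λ v → Σ (Fin n) λ w →
  Adj G u v × Adj G v w × Adj G u w

-- Let u v w be a triangle of Gᶜ and u-v-x-y the unique quadrilateral of Gᶜ through uv.
-- One may assume w ∉ {x, y}: otherwise the quadrilateral through another edge of the
-- triangle avoids the third vertex, or two quadrilaterals through one edge would collide.
-- Comparing with u-v-x-w and u-v-w-y then forces w to be G-adjacent to x and y. Let
-- u-w-a-b and v-w-a'-b' be the quadrilaterals of Gᶜ through uw and vw; in the same way
-- b is a common G-neighbour of w and x, and b' one of w and y. If b = b', the G-edge wb
-- lies in the two triangles wbx and wby. Otherwise b, b' are G-adjacent (else u-v-b'-b is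
-- a second quadrilateral through uv), and the G-edge wb' lies in wb'b and wb'y.
module Submission where

open import Defs
open import Data.Nat using (ℕ)
open import Data.Fin using (Fin; _≟_)
open import Data.Product using (_×_; _,_; proj₁; proj₂; ∃₂)
open import Data.Product.Properties using (,-injective)
open import Data.Empty using (⊥)
open import Relation.Nullary using (¬_; yes; no)
open import Relation.Binary.PropositionalEquality using (_≡_; _≢_; refl; trans; ≢-sym)
  renaming (sym to ≡-sym)

module _ {n : ℕ} (H : SimpleGraph n) where

  adj⇒≢ : ∀ {u v} → Adj H u v → u ≢ v
  adj⇒≢ a refl = irrefl H a

  -- The closed walk u - v - x - y - u, a 4-cycle thanks to the two diagonal conditions.
  record Cycle₄ (u v x y : Fin n) : Set where
    field
      edge₁ : Adj H u v
      edge₂ : Adj H v x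
      edge₃ : Adj H x y
      edge₄ : Adj H y u
      u≢x   : u ≢ x
      v≢y   : v ≢ y

  open Cycle₄

  Cycle₄⇒QuadThrough : ∀ {u v x y} → Cycle₄ u v x y → QuadThrough H u v (x , y)
  Cycle₄⇒QuadThrough c =
    adj⇒≢ (edge₁ c) , u≢x c , ≢-sym (adj⇒≢ (edge₄ c)) , adj⇒≢ (edge₂ c) , v≢y c ,
    adj⇒≢ (edge₃ c) , edge₂ c , edge₃ c , edge₄ c

  QuadThrough⇒Cycle₄ : ∀ {u v x y} → Adj H u v → QuadThrough H u v (x , y) → Cycle₄ u v x y
  QuadThrough⇒Cycle₄ uv (_ , u≢x , _ , _ , v≢y , _ , vx , xy , yu) =
    record { edge₁ = uv ; edge₂ = vx ; edge₃ = xy ; edge₄ = yu ; u≢x = u≢x ; v≢y = v≢y }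

  rotate : ∀ {u v x y} → Cycle₄ u v x y → Cycle₄ v x y u
  rotate c = record
    { edge₁ = edge₂ c ; edge₂ = edge₃ c ; edge₃ = edge₄ c ; edge₄ = edge₁ c
    ; u≢x = v≢y c ; v≢y = ≢-sym (u≢x c) }

  reverse : ∀ {u v x y} → Cycle₄ u v x y → Cycle₄ v u y x
  reverse c = record
    { edge₁ = sym H (edge₁ c) ; edge₂ = sym H (edge₄ c) ; edge₃ = sym H (edge₃ c)
    ; edge₄ = sym H (edge₂ c) ; u≢x = v≢y c ; v≢y = u≢x c }

open Cycle₄

module _ {n : ℕ} {G : SimpleGraph n} where

  private
    Gᶜ : SimpleGraph n
    Gᶜ = complement G

  module _ (p3 : P3 G) where

    cycle-through : ∀ {u v} → Adj Gᶜ u v → ∃₂ λ x y → Cycle₄ Gᶜ u v x y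
    cycle-through {u} {v} uv with p3 u v uv
    ... | (x , y) , q , _ = x , y , QuadThrough⇒Cycle₄ Gᶜ uv q

    cycle-unique : ∀ {u v x y x′ y′} → Cycle₄ Gᶜ u v x y → Cycle₄ Gᶜ u v x′ y′ →
                   x ≡ x′ × y ≡ y′
    cycle-unique {u} {v} c c′ with p3 u v (edge₁ c)
    ... | _ , _ , unique =
      ,-injective (trans (unique _ (Cycle₄⇒QuadThrough Gᶜ c))
                         (≡-sym (unique _ (Cycle₄⇒QuadThrough Gᶜ c′))))

  common-neighbour-unique : P2 G → ∀ {p q r s} → Adj G p q →
                            Adj G p r → Adj G q r → Adj G p s → Adj G q s → r ≡ s
  common-neighbour-unique p2 {p} {q} pq pr qr ps qs with p2 p q pq
  ... | _ , _ , unique = trans (unique _ (pr , qr)) (≡-sym (unique _ (ps , qs)))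

  module _ (p2 : P2 G) (p3 : P3 G) where

    module Flank {u v w x y a b : Fin n}
      (uv : Adj Gᶜ u v) (vw : Adj Gᶜ v w) (uw : Adj Gᶜ u w)
      (c : Cycle₄ Gᶜ u v x y) (w≢x : w ≢ x) (w≢y : w ≢ y) (d : Cycle₄ Gᶜ u w a b) where

      ¬¬adj-w-x : ¬ ¬ Adj G w x
      ¬¬adj-w-x ¬wx = w≢y (≡-sym (proj₂ (cycle-unique p3 c c′)))
        where
        c′ : Cycle₄ Gᶜ u v x w
        c′ = record { edge₁ = uv ; edge₂ = edge₂ c ; edge₃ = sym Gᶜ (w≢x , ¬wx)
                    ; edge₄ = sym Gᶜ uw ; u≢x = u≢x c ; v≢y = adj⇒≢ Gᶜ vw }

      b≢v : b ≢ v
      b≢v refl = w≢y (proj₂ (cycle-unique p3 (rotate Gᶜ (reverse Gᶜ d)) c))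

      ¬¬adj-w-b : ¬ ¬ Adj G w b
      ¬¬adj-w-b ¬wb = w≢x (proj₁ (cycle-unique p3 c′ c))
        where
        c′ : Cycle₄ Gᶜ u v w b
        c′ = record { edge₁ = uv ; edge₂ = vw ; edge₃ = (v≢y d , ¬wb) ; edge₄ = edge₄ d
                    ; u≢x = adj⇒≢ Gᶜ uw ; v≢y = ≢-sym b≢v }

      -- Otherwise v-x-u-w would be a second quadrilateral through vx.
      ¬adj-u-x : ¬ Adj Gᶜ u x
      ¬adj-u-x ux = adj⇒≢ Gᶜ (edge₄ c) (proj₁ (cycle-unique p3 (rotate Gᶜ c) c′))
        where
        c′ : Cycle₄ Gᶜ v x u w
        c′ = record { edge₁ = edge₂ c ; edge₂ = sym Gᶜ ux ; edge₃ = uw ; edge₄ = sym Gᶜ vw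
                    ; u≢x = ≢-sym (adj⇒≢ Gᶜ uv) ; v≢y = ≢-sym w≢x }

      b≢x : b ≢ x
      b≢x refl = ¬adj-u-x (sym Gᶜ (edge₄ d))

      b≢y : b ≢ y
      b≢y refl = adj⇒≢ Gᶜ vw (proj₁ (cycle-unique p3 c″ d″))
        where
        c″ : Cycle₄ Gᶜ y u v x
        c″ = rotate Gᶜ (rotate Gᶜ (rotate Gᶜ c))
        d″ : Cycle₄ Gᶜ y u w a
        d″ = rotate Gᶜ (rotate Gᶜ (rotate Gᶜ d))

      ¬¬adj-b-x : ¬ ¬ Adj G b x
      ¬¬adj-b-x ¬bx = b≢y (proj₂ (cycle-unique p3 c′ c))
        where
        c′ : Cycle₄ Gᶜ u v x b
        c′ = record { edge₁ = uv ; edge₂ = edge₂ c ; edge₃ = sym Gᶜ (b≢x , ¬bx)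
                    ; edge₄ = edge₄ d ; u≢x = u≢x c ; v≢y = ≢-sym b≢v }

    avoiding-cycle-contradiction :
      ∀ {u v w x y} → Adj Gᶜ u v → Adj Gᶜ v w → Adj Gᶜ u w →
      Cycle₄ Gᶜ u v x y → w ≢ x → w ≢ y → ⊥
    avoiding-cycle-contradiction {u} {v} {w} {x} {y} uv vw uw c w≢x w≢y
      with cycle-through p3 uw | cycle-through p3 vw
    ... | _ , b , d | _ , b′ , d′ =
      F.¬¬adj-w-x λ wx → F.¬¬adj-w-b λ wb → F.¬¬adj-b-x λ bx →
      F′.¬¬adj-w-x λ wy → F′.¬¬adj-w-b λ wb′ → F′.¬¬adj-b-x λ b′y → common-neighbours-contradiction wx wb bx wy wb′ b′y
      where
      module F  = Flank uv vw uw c w≢x w≢y d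
      module F′ = Flank (sym Gᶜ uv) uw vw (reverse Gᶜ c) w≢y w≢x d′

      common-neighbours-contradiction : Adj G w x → Adj G w b → Adj G b x →
               Adj G w y → Adj G w b′ → Adj G b′ y → ⊥
      common-neighbours-contradiction wx wb bx wy wb′ b′y with b ≟ b′
      ... | yes refl = adj⇒≢ Gᶜ (edge₃ c) (common-neighbour-unique p2 wb wx bx wy b′y)
      ... | no b≢b′ = ¬¬adj-b′-b λ b′b →
                        F.b≢y (common-neighbour-unique p2 wb′ wb b′b wy b′y)
        where
        ¬¬adj-b′-b : ¬ ¬ Adj G b′ b
        ¬¬adj-b′-b ¬b′b = F.b≢y (proj₂ (cycle-unique p3 c′ c))
          where
          c′ : Cycle₄ Gᶜ u v b′ b
          c′ = record { edge₁ = uv ; edge₂ = sym Gᶜ (edge₄ d′)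
                      ; edge₃ = (≢-sym b≢b′ , ¬b′b) ; edge₄ = edge₄ d
                      ; u≢x = ≢-sym F′.b≢v ; v≢y = ≢-sym F.b≢v }

    cycle-through-apex-contradiction :
      ∀ {u v w y} → Adj Gᶜ u v → Adj Gᶜ v w → Adj Gᶜ u w → Cycle₄ Gᶜ u v w y → ⊥
    cycle-through-apex-contradiction {v = v} uv vw uw c with cycle-through p3 uw
    ... | a , b , d with v ≟ a | v ≟ b
    ...   | yes refl | _ =
      adj⇒≢ Gᶜ (edge₄ c) (proj₁ (cycle-unique p3 (rotate Gᶜ c) (reverse Gᶜ (rotate Gᶜ d))))
    ...   | no _ | yes refl =
      adj⇒≢ Gᶜ (edge₂ d) (proj₁ (cycle-unique p3 c (rotate Gᶜ (reverse Gᶜ d))))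
    ...   | no v≢a | no v≢b =
      avoiding-cycle-contradiction uw (sym Gᶜ vw) uv d v≢a v≢b

    complement-triangle-free : ¬ HasTriangle Gᶜ
    complement-triangle-free (u , v , w , uv , vw , uw) with cycle-through p3 uv
    ... | x , y , c with w ≟ x | w ≟ y
    ...   | yes refl | _ = cycle-through-apex-contradiction uv vw uw c
    ...   | no _ | yes refl = cycle-through-apex-contradiction (sym Gᶜ uv) uw vw (reverse Gᶜ c)
    ...   | no w≢x | no w≢y = avoiding-cycle-contradiction uv vw uw c w≢x w≢y

lemma1 : ∀ {n : ℕ} (G : SimpleGraph n) → P2 G → P3 G → ¬ HasTriangle (complement G)
lemma1 G = complement-triangle-free {G = G}
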